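{- Let $\Lambda$ be a linear order. Every closed formula $\phi$ of $\mathcal{L}_\Lambda$ is equivalent in $\mathsf{GLP}_\Lambda$ to a Boolean combination $\mathsf{BCW}(\phi)$ of worms such that $\mathrm{mod}(\mathsf{BCW}(\phi))\subseteq\mathrm{mod}(\phi)$.
   Context: $\mathcal{L}_\Lambda$ is the modal language with modalities $[\alpha]$, $\alpha\in|\Lambda|$, $\langle\alpha\rangle:=\neg[\alpha]\neg$; a closed formula is one built from $\top$ with $\neg,\wedge$ and modalities, without propositional variables. $\mathsf{GLP}_\Lambda$ is axiomatized by propositional tautologies and, for all $\alpha,\beta$: (i) $[\alpha](\chi\to\psi)\to([\alpha]\chi\to[\alpha]\psi)$; (ii) $[\alpha]([\alpha]\chi\to\chi)\to[\alpha]\chi$; (iii) $[\alpha]\chi\to[\beta][\alpha]\chi$ for $\alpha\le\beta$; (iv) $\langle\alpha\rangle\chi\to[\beta]\langle\alpha\rangle\chi$ for $\alpha<\beta$; (v) $[\alpha]\chi\to[\beta]\chi$ for $\alpha\le\beta$; with modus ponens and necessitation. A worm is a formula $\langle\alpha_1\rangle\cdots\langle\alpha_n\rangle\top$ ($n\ge0$). $\mathrm{mod}(\psi)$ denotes the set of modals occurring in $\psi$. -}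

module Defs where

open import Level using (Level)
open import Data.Nat using (ℕ)
open import Data.Bool using (Bool; true; false; not; _∧_)
open import Data.Empty using (⊥)
open import Data.Unit using (⊤)
open import Data.Product using (_×_)
open import Data.Sum using (_⊎_)
open import Relation.Binary.PropositionalEquality using (_≡_)
open import Relation.Binary.Bundles using (StrictTotalOrder)

module GLP {a ℓ₁ ℓ₂ : Level} (Λ : StrictTotalOrder a ℓ₁ ℓ₂) where
  open StrictTotalOrder Λ renaming (Carrier to Mod)

  data Fm : Set a where
    var  : ℕ → Fm
    ⊤'   : Fm
    ¬'_  : Fm → Fm
    _∧'_ : Fm → Fm → Fm
    [_]_ : Mod → Fm → Fm

  infixr 6 _∧'_
  infixr 4 _⇒_ _⇔_
  infix 7 ¬'_
  infix 8 [_]_ ⟨_⟩_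

  ⊥' : Fm
  ⊥' = ¬' ⊤'

  _∨'_ : Fm → Fm → Fm
  φ ∨' ψ = ¬' (¬' φ ∧' ¬' ψ)

  _⇒_ : Fm → Fm → Fm
  φ ⇒ ψ = ¬' (φ ∧' ¬' ψ)

  _⇔_ : Fm → Fm → Fm
  φ ⇔ ψ = (φ ⇒ ψ) ∧' (ψ ⇒ φ)

  ⟨_⟩_ : Mod → Fm → Fm
  ⟨ α ⟩ φ = ¬' ([ α ] (¬' φ))

  -- propositional truth value, treating variables and [α]-formulas as atoms
  eval : (Fm → Bool) → Fm → Bool
  eval v (var n)   = v (var n)
  eval v ⊤'        = true
  eval v (¬' φ)    = not (eval v φ)
  eval v (φ ∧' ψ)  = eval v φ ∧ eval v ψ
  eval v ([ α ] φ) = v ([ α ] φ)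

  Tautology : Fm → Set a
  Tautology φ = (v : Fm → Bool) → eval v φ ≡ true

  data ⊢_ : Fm → Set (a Level.⊔ ℓ₁ Level.⊔ ℓ₂) where
    taut : ∀ {φ} → Tautology φ → ⊢ φ
    axK  : ∀ α χ ψ → ⊢ ([ α ] (χ ⇒ ψ) ⇒ ([ α ] χ ⇒ [ α ] ψ))
    axL  : ∀ α χ → ⊢ ([ α ] ([ α ] χ ⇒ χ) ⇒ [ α ] χ)
    ax3  : ∀ α β χ → (α < β ⊎ α ≈ β) → ⊢ ([ α ] χ ⇒ [ β ] ([ α ] χ))
    ax4  : ∀ α β χ → α < β → ⊢ (⟨ α ⟩ χ ⇒ [ β ] (⟨ α ⟩ χ))
    ax5  : ∀ α β χ → (α < β ⊎ α ≈ β) → ⊢ ([ α ] χ ⇒ [ β ] χ)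
    mp   : ∀ {φ ψ} → ⊢ (φ ⇒ ψ) → ⊢ φ → ⊢ ψ
    nec  : ∀ {φ} α → ⊢ φ → ⊢ ([ α ] φ)

  infix 2 ⊢_

  Closed : Fm → Set
  Closed (var n)   = ⊥
  Closed ⊤'        = ⊤
  Closed (¬' φ)    = Closed φ
  Closed (φ ∧' ψ)  = Closed φ × Closed ψ
  Closed ([ α ] φ) = Closed φ

  data Worm : Fm → Set a where
    top  : Worm ⊤'
    cons : ∀ α {w} → Worm w → Worm (⟨ α ⟩ w)

  data BCW : Fm → Set a where
    worm : ∀ {w} → Worm w → BCW w
    neg  : ∀ {φ} → BCW φ → BCW (¬' φ)
    conj : ∀ {φ ψ} → BCW φ → BCW ψ → BCW (φ ∧' ψ)

  _∈mod_ : Mod → Fm → Set (a Level.⊔ ℓ₁)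
  α ∈mod var n     = Level.Lift _ ⊥
  α ∈mod ⊤'        = Level.Lift _ ⊥
  α ∈mod (¬' φ)    = α ∈mod φ
  α ∈mod (φ ∧' ψ)  = α ∈mod φ ⊎ α ∈mod ψ
  α ∈mod ([ β ] φ) = α ≡ β ⊎ α ∈mod φ

-- Boolean combinations of worms are closed under ¬ and ∧, so it suffices that ⟨α⟩ of such a
-- combination is again one, without new modalities besides α.  In disjunctive normal form,
-- ⟨α⟩ distributes over the disjunction.  A worm splits as W h ∧ ⟨β⟩ W r with h ≥ α > β, and
-- ⟨β⟩ W r and its negation are α-persistent by axioms (iii) and (iv), so they leave ⟨α⟩.
-- What remains is ⟨α⟩(A₁ ∧ … ∧ Aₘ ∧ ¬ B₁ ∧ … ∧ ¬ Bₖ) with worms above α.  The Aᵢ merge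
-- into one worm A, and since the worms above α are linearly ordered by
-- A <_α B ⟺ B ⊢ ⟨α⟩ A, each ¬ Bⱼ is either refuted by A or follows from A ∧ [α] ¬ A.  By
-- Löb, ⟨α⟩ A ⊢ ⟨α⟩ (A ∧ [α] ¬ A), so the term is ⊥ or ⟨α⟩ A, again a worm.

module Submission where

open import Defs
open import Level using (Level; _⊔_; lift)
open import Data.Bool using (Bool; true; false; not; _∧_; _∨_; T; T?)
open import Data.Bool.Properties
  using ( T-≡; T-∧; not-involutive; ∧-assoc; ∨-assoc; ∧-zeroʳ; ∧-identityʳ; ∨-identityʳ
        ; ∧-distribˡ-∨; ∧-distribʳ-∨; ∧-commutativeMonoid; ∨-∧-booleanAlgebra)
open import Algebra.Lattice.Properties.BooleanAlgebra ∨-∧-booleanAlgebra using (deMorgan₁)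
open import Algebra.Solver.CommutativeMonoid ∧-commutativeMonoid using (solve; _⊕_; _⊜_)
open import Data.Empty using (⊥-elim)
open import Data.Unit using (tt)
open import Data.Nat using (ℕ; zero; suc; _+_; s≤s; z≤n) renaming (_≤_ to _≤ℕ_; _<_ to _<ℕ_)
open import Data.Nat.Properties
  using (≤-refl; +-mono-<-≤; +-mono-≤-<; +-monoʳ-<; +-comm; m<m+n; ≤-pred; n<1+n)
  renaming (<-≤-trans to <-≤ℕ-trans)
open import Data.List using (List; []; _∷_; _++_; length; map; cartesianProductWith)
open import Data.List.Properties using (length-++; length-++-≤ˡ; length-++-≤ʳ)
open import Data.List.Relation.Unary.All as All using (All; []; _∷_; lookup)
open import Data.List.Relation.Unary.All.Properties using (++⁺; ++⁻ˡ; ++⁻ʳ; cartesianProductWith⁺)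
open import Data.List.Relation.Unary.Any using (here; there)
open import Data.List.Relation.Unary.First as First using (first)
open import Data.List.Relation.Unary.First.Properties using (toView)
open import Data.List.Membership.Propositional using (_∈_)
open import Data.List.Membership.Propositional.Properties using (∈-++⁻)
open import Data.List.Relation.Binary.Subset.Propositional using (_⊆_)
open import Data.List.Relation.Binary.Subset.Propositional.Properties
  using (⊆-refl; ⊆-trans; xs⊆xs++ys; xs⊆ys++xs; xs⊆x∷xs; ∈-∷⁺ʳ; All-resp-⊇)
  renaming (++⁺ to ++-⊆⁺)
open import Data.Product using (Σ; Σ-syntax; _×_; _,_; proj₁; proj₂)
open import Data.Sum using (_⊎_; inj₁; inj₂; [_,_]′)
open import Function.Base using (_∘_; id)
open import Function.Bundles using (Equivalence)
open import Relation.Nullary using (¬_)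
open import Relation.Nullary.Decidable using (map′; decidable-stable; toSum)
open import Relation.Binary.PropositionalEquality
  using (_≡_; _≢_; refl; subst; sym; trans; cong; cong₂; setoid; module ≡-Reasoning)
open import Relation.Binary.Bundles using (StrictTotalOrder; DecTotalOrder)
open import Relation.Binary.Definitions using (tri<; tri≈; tri>)

module WormNormalForm {a ℓ₁ ℓ₂ : Level} (Λ : StrictTotalOrder a ℓ₁ ℓ₂) where
  open StrictTotalOrder Λ
    using (_<_; _≈_; module Eq; compare; irrefl; <-respˡ-≈; <-respʳ-≈; _<?_) renaming (Carrier to Mod)
  open GLP Λ
  open import Relation.Binary.Properties.StrictTotalOrder Λ using (decTotalOrder)
  open DecTotalOrder decTotalOrder using (_≤_; totalOrder)
  import Relation.Binary.Construct.StrictToNonStrict _≈_ _<_ as NonStrict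
  open import Data.List.Extrema totalOrder using (min; argmin-sel; min≤⊤; min≤xs)

  private variable
    φ ψ χ φ′ ψ′ : Fm
    α β γ δ : Mod
    A B h b : List Mod

  ≤⊎> : ∀ α β → α ≤ β ⊎ β < α
  ≤⊎> α β with compare α β
  ... | tri< α<β _ _ = inj₁ (inj₁ α<β)
  ... | tri≈ _ α≈β _ = inj₁ (inj₂ α≈β)
  ... | tri> _ _ β<α = inj₂ β<α

  <-≤-trans : α < β → β ≤ γ → α < γ
  <-≤-trans = NonStrict.<-≤-trans (StrictTotalOrder.trans Λ) <-respʳ-≈

  -- Propositional reasoning via truth tables

  -- A record rather than T (eval v φ), so that φ can be inferred from v ⊨ φ.
  infix 3.5 _⊨_
  record _⊨_ (v : Fm → Bool) (φ : Fm) : Set where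
    constructor holds
    field truth : T (eval v φ)
  open _⊨_

  module _ {v : Fm → Bool} where
    ⊨-stable : ¬ ¬ v ⊨ φ → v ⊨ φ
    ⊨-stable = decidable-stable (map′ holds truth (T? _))

    ⊨⊤ : v ⊨ ⊤'
    ⊨⊤ = holds tt

    ⊨¬⁺ : ¬ v ⊨ φ → v ⊨ ¬' φ
    ⊨¬⁺ {φ} ¬t = holds (not-T (eval v φ) (¬t ∘ holds))
      where
      not-T : ∀ b → ¬ T b → T (not b)
      not-T false _  = tt
      not-T true  ¬t = ¬t tt

    ⊨¬⁻ : v ⊨ ¬' φ → ¬ v ⊨ φ
    ⊨¬⁻ {φ} (holds t) (holds u) = T-not (eval v φ) t u
      where
      T-not : ∀ b → T (not b) → ¬ T b
      T-not false _ ()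
      T-not true  ()

    ⊨∧⁺ : v ⊨ φ → v ⊨ ψ → v ⊨ φ ∧' ψ
    ⊨∧⁺ (holds t) (holds u) = holds (Equivalence.from T-∧ (t , u))

    ⊨∧⁻ : v ⊨ φ ∧' ψ → v ⊨ φ × v ⊨ ψ
    ⊨∧⁻ (holds t) = let t₁ , t₂ = Equivalence.to T-∧ t in holds t₁ , holds t₂

    ⊨⇒⁺ : (v ⊨ φ → v ⊨ ψ) → v ⊨ φ ⇒ ψ
    ⊨⇒⁺ f = ⊨¬⁺ λ h → let p , ¬q = ⊨∧⁻ h in ⊨¬⁻ ¬q (f p)

    ⊨⇒⁻ : v ⊨ φ ⇒ ψ → v ⊨ φ → v ⊨ ψ
    ⊨⇒⁻ h p = ⊨-stable λ ¬q → ⊨¬⁻ h (⊨∧⁺ p (⊨¬⁺ ¬q))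

  valid : (∀ v → v ⊨ φ) → ⊢ φ
  valid h = taut λ v → Equivalence.to T-≡ (truth (h v))

  infix 3 _⊩_ _⟺_
  _⊩_ : Fm → Fm → Set (a ⊔ ℓ₁ ⊔ ℓ₂)
  φ ⊩ ψ = ⊢ (φ ⇒ ψ)

  tautological : (∀ v → v ⊨ φ → v ⊨ ψ) → φ ⊩ ψ
  tautological h = valid λ v → ⊨⇒⁺ (h v)

  ⊢-tautological : (∀ v → v ⊨ φ → v ⊨ ψ) → ⊢ φ → ⊢ ψ
  ⊢-tautological h = mp (tautological h)

  ⊢-tautological₂ : (∀ v → v ⊨ φ → v ⊨ ψ → v ⊨ χ) → ⊢ φ → ⊢ ψ → ⊢ χ
  ⊢-tautological₂ h ⊢φ = mp (⊢-tautological (λ v p → ⊨⇒⁺ (h v p)) ⊢φ)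

  ⊩-tautological₂ : (∀ v → v ⊨ φ → v ⊨ ψ → v ⊨ χ) → φ′ ⊩ φ → φ′ ⊩ ψ → φ′ ⊩ χ
  ⊩-tautological₂ h = ⊢-tautological₂ λ v f g → ⊨⇒⁺ λ c → h v (⊨⇒⁻ f c) (⊨⇒⁻ g c)

  ⊩-refl : φ ⊩ φ
  ⊩-refl = tautological λ _ p → p

  infixl 5 _∙_
  _∙_ : φ ⊩ ψ → ψ ⊩ χ → φ ⊩ χ
  _∙_ = ⊢-tautological₂ λ _ f g → ⊨⇒⁺ (⊨⇒⁻ g ∘ ⊨⇒⁻ f)

  ⊢⇒⊩ : ⊢ ψ → φ ⊩ ψ
  ⊢⇒⊩ = ⊢-tautological λ _ q → ⊨⇒⁺ λ _ → q

  ⊩-mp : χ ⊩ φ ⇒ ψ → χ ⊩ φ → χ ⊩ ψ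
  ⊩-mp = ⊩-tautological₂ λ _ → ⊨⇒⁻

  ⊩-absurd : χ ⊩ φ → χ ⊩ ¬' φ → χ ⊩ ψ
  ⊩-absurd = ⊩-tautological₂ λ _ p ¬p → ⊥-elim (⊨¬⁻ ¬p p)

  ⊤-intro : φ ⊩ ⊤'
  ⊤-intro = tautological λ _ _ → ⊨⊤

  ⊥-elim⊩ : ⊥' ⊩ φ
  ⊥-elim⊩ = tautological λ _ ⊥ → ⊥-elim (⊨¬⁻ ⊥ ⊨⊤)

  ∧-intro : χ ⊩ φ → χ ⊩ ψ → χ ⊩ φ ∧' ψ
  ∧-intro = ⊩-tautological₂ λ _ → ⊨∧⁺

  ∧-elimˡ : φ ∧' ψ ⊩ φ
  ∧-elimˡ = tautological λ _ → proj₁ ∘ ⊨∧⁻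

  ∧-elimʳ : φ ∧' ψ ⊩ ψ
  ∧-elimʳ = tautological λ _ → proj₂ ∘ ⊨∧⁻

  ∧-mono : φ ⊩ φ′ → ψ ⊩ ψ′ → φ ∧' ψ ⊩ φ′ ∧' ψ′
  ∧-mono f g = ∧-intro (∧-elimˡ ∙ f) (∧-elimʳ ∙ g)

  ∧-comm : φ ∧' ψ ⊩ ψ ∧' φ
  ∧-comm = ∧-intro ∧-elimʳ ∧-elimˡ

  ∨-elim : φ ⊩ χ → ψ ⊩ χ → φ ∨' ψ ⊩ χ
  ∨-elim = ⊢-tautological₂ λ _ f g → ⊨⇒⁺ λ p∨q →
    ⊨-stable λ ¬r → ⊨¬⁻ p∨q (⊨∧⁺ (⊨¬⁺ (¬r ∘ ⊨⇒⁻ f)) (⊨¬⁺ (¬r ∘ ⊨⇒⁻ g)))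

  ∨-introˡ : φ ⊩ φ ∨' ψ
  ∨-introˡ = tautological λ _ p → ⊨¬⁺ λ h → ⊨¬⁻ (proj₁ (⊨∧⁻ h)) p

  ∨-introʳ : ψ ⊩ φ ∨' ψ
  ∨-introʳ = tautological λ _ q → ⊨¬⁺ λ h → ⊨¬⁻ (proj₂ (⊨∧⁻ h)) q

  contrapose : φ ⊩ ψ → ¬' ψ ⊩ ¬' φ
  contrapose = ⊢-tautological λ _ f → ⊨⇒⁺ λ ¬q → ⊨¬⁺ (⊨¬⁻ ¬q ∘ ⊨⇒⁻ f)

  ¬¬-intro : φ ⊩ ¬' ¬' φ
  ¬¬-intro = tautological λ _ p → ⊨¬⁺ λ ¬p → ⊨¬⁻ ¬p p

  ¬¬-elim : ¬' ¬' φ ⊩ φ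
  ¬¬-elim = tautological λ _ ¬¬p → ⊨-stable (⊨¬⁻ ¬¬p ∘ ⊨¬⁺)

  ¬-∧-elim : ¬' (φ ∧' ψ) ⊩ (¬' φ) ∨' (¬' ψ)
  ¬-∧-elim = tautological λ _ ¬pq → ⊨¬⁺ λ h → let ¬¬p , ¬¬q = ⊨∧⁻ h in
    ⊨¬⁻ ¬pq (⊨∧⁺ (⊨-stable (⊨¬⁻ ¬¬p ∘ ⊨¬⁺)) (⊨-stable (⊨¬⁻ ¬¬q ∘ ⊨¬⁺)))

  contrapose⁻ : ¬' φ ⊩ ¬' ψ → ψ ⊩ φ
  contrapose⁻ f = ¬¬-intro ∙ contrapose f ∙ ¬¬-elim

  ⊢¬⊥ : ⊢ ¬' ⊥'
  ⊢¬⊥ = valid λ _ → ⊨¬⁺ λ ⊥ → ⊨¬⁻ ⊥ ⊨⊤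

  explode : ⊢ ¬' φ → φ ⊩ ψ
  explode ⊢¬φ = ⊩-absurd ⊩-refl (⊢⇒⊩ ⊢¬φ)

  refute : φ ⊩ ⊥' → ⊢ ¬' φ
  refute = ⊢-tautological λ _ f → ⊨¬⁺ λ p → ⊨¬⁻ (⊨⇒⁻ f p) ⊨⊤

  ⊩-¬-intro : φ ∧' ψ ⊩ ¬' χ → φ ⊩ χ → φ ⊩ ¬' ψ
  ⊩-¬-intro = ⊢-tautological₂ λ _ f g → ⊨⇒⁺ λ p → ⊨¬⁺ λ q → ⊨¬⁻ (⊨⇒⁻ f (⊨∧⁺ p q)) (⊨⇒⁻ g p)

  _⟺_ : Fm → Fm → Set (a ⊔ ℓ₁ ⊔ ℓ₂)
  φ ⟺ ψ = (φ ⊩ ψ) × (ψ ⊩ φ)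

  ⟺-refl : φ ⟺ φ
  ⟺-refl = ⊩-refl , ⊩-refl

  ⟺-sym : φ ⟺ ψ → ψ ⟺ φ
  ⟺-sym (f , g) = g , f

  infixl 5 _⟫_
  _⟫_ : φ ⟺ ψ → ψ ⟺ χ → φ ⟺ χ
  (f , g) ⟫ (f′ , g′) = f ∙ f′ , g′ ∙ g

  ¬-cong : φ ⟺ ψ → ¬' φ ⟺ ¬' ψ
  ¬-cong (f , g) = contrapose g , contrapose f

  ∧-cong : φ ⟺ φ′ → ψ ⟺ ψ′ → φ ∧' ψ ⟺ φ′ ∧' ψ′
  ∧-cong (f , g) (f′ , g′) = ∧-mono f f′ , ∧-mono g g′

  ∧-interchange : (φ ∧' ψ) ∧' (φ′ ∧' ψ′) ⟺ (φ ∧' φ′) ∧' (ψ ∧' ψ′)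
  ∧-interchange = ∧-intro (∧-mono ∧-elimˡ ∧-elimˡ) (∧-mono ∧-elimʳ ∧-elimʳ)
                , ∧-intro (∧-mono ∧-elimˡ ∧-elimˡ) (∧-mono ∧-elimʳ ∧-elimʳ)

  ⟺-by-eval : (∀ v → eval v φ ≡ eval v ψ) → φ ⟺ ψ
  ⟺-by-eval h = tautological (λ v (holds t) → holds (subst T (h v) t))
              , tautological (λ v (holds t) → holds (subst T (sym (h v)) t))

  ⟺⇒⊢⇔ : φ ⟺ ψ → ⊢ (φ ⇔ ψ)
  ⟺⇒⊢⇔ (f , g) = ⊢-tautological₂ (λ _ → ⊨∧⁺) f g

  □-mono : φ ⊩ ψ → [ α ] φ ⊩ [ α ] ψ
  □-mono {α = α} f = mp (axK α _ _) (nec α f)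

  ◇-mono : φ ⊩ ψ → ⟨ α ⟩ φ ⊩ ⟨ α ⟩ ψ
  ◇-mono f = contrapose (□-mono (contrapose f))

  ◇-cong : φ ⟺ ψ → ⟨ α ⟩ φ ⟺ ⟨ α ⟩ ψ
  ◇-cong (f , g) = ◇-mono f , ◇-mono g

  □-◇-duality : [ α ] φ ⟺ ¬' ⟨ α ⟩ (¬' φ)
  □-◇-duality = □-mono ¬¬-intro ∙ ¬¬-intro , ¬¬-elim ∙ □-mono ¬¬-elim

  □-∧ : [ α ] φ ∧' [ α ] ψ ⊩ [ α ] (φ ∧' ψ)
  □-∧ {α} {φ} {ψ} = ⊩-mp (∧-elimˡ ∙ □-mono pair ∙ axK α ψ (φ ∧' ψ)) ∧-elimʳ
    where
    pair : φ ⊩ ψ ⇒ φ ∧' ψ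
    pair = tautological λ _ p → ⊨⇒⁺ (⊨∧⁺ p)

  ◇-∧-□ : ⟨ α ⟩ φ ∧' [ α ] ψ ⊩ ⟨ α ⟩ (φ ∧' ψ)
  ◇-∧-□ {α} {φ} {ψ} = ⊩-tautological₂ (λ _ ¬□¬φ □¬φ∧ψ⇒□¬φ → ⊨¬⁺ (⊨¬⁻ ¬□¬φ ∘ ⊨⇒⁻ □¬φ∧ψ⇒□¬φ))
    ∧-elimˡ (∧-elimʳ ∙ □-mono narrow ∙ axK α _ _)
    where
    narrow : ψ ⊩ ¬' (φ ∧' ψ) ⇒ ¬' φ
    narrow = tautological λ _ q → ⊨⇒⁺ λ ¬pq → ⊨¬⁺ λ p → ⊨¬⁻ ¬pq (⊨∧⁺ p q)

  ◇-distrib-∨ : ⟨ α ⟩ (φ ∨' ψ) ⟺ (⟨ α ⟩ φ) ∨' (⟨ α ⟩ ψ)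
  ◇-distrib-∨ = contrapose (∧-mono ¬¬-elim ¬¬-elim ∙ □-∧ ∙ □-mono ¬¬-intro)
              , ∨-elim (◇-mono ∨-introˡ) (◇-mono ∨-introʳ)

  ◇-antitone : α ≤ β → ⟨ β ⟩ φ ⊩ ⟨ α ⟩ φ
  ◇-antitone {α} {β} α≤β = contrapose (ax5 α β _ α≤β)

  ◇-idem : ⟨ α ⟩ ⟨ α ⟩ φ ⊩ ⟨ α ⟩ φ
  ◇-idem {α} = contrapose (ax3 α α _ (inj₂ Eq.refl) ∙ □-mono ¬¬-intro)

  ◇-persist : β < γ → ⟨ γ ⟩ φ ∧' ⟨ β ⟩ ψ ⊩ ⟨ γ ⟩ (φ ∧' ⟨ β ⟩ ψ)
  ◇-persist {β} {γ} β<γ = ∧-mono ⊩-refl (ax4 β γ _ β<γ) ∙ ◇-∧-□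

  ◇-löb : ⟨ α ⟩ φ ⊩ ⟨ α ⟩ (φ ∧' [ α ] (¬' φ))
  ◇-löb {α} {φ} = contrapose (□-mono unfold ∙ axL α (¬' φ))
    where
    unfold : ¬' (φ ∧' [ α ] (¬' φ)) ⊩ [ α ] (¬' φ) ⇒ ¬' φ
    unfold = tautological λ _ ¬conj → ⊨⇒⁺ λ □¬p → ⊨¬⁺ λ p → ⊨¬⁻ ¬conj (⊨∧⁺ p □¬p)

  löb-rule : φ ⊩ ⟨ α ⟩ φ → ⊢ ¬' φ
  löb-rule {φ} {α} f = mp reflection (mp (axL α (¬' φ)) (nec α reflection))
    where
    reflection : [ α ] (¬' φ) ⊩ ¬' φ
    reflection = ¬¬-intro ∙ contrapose f

  ◇-resp-≈ : β ≈ γ → ⟨ β ⟩ φ ⟺ ⟨ γ ⟩ φ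
  ◇-resp-≈ β≈γ = ◇-antitone (inj₂ (Eq.sym β≈γ)) , ◇-antitone (inj₂ β≈γ)

  ◇-∧-◇ : β < γ → ⟨ γ ⟩ (φ ∧' ⟨ β ⟩ ψ) ⟺ ⟨ γ ⟩ φ ∧' ⟨ β ⟩ ψ
  ◇-∧-◇ β<γ = ∧-intro (◇-mono ∧-elimˡ) (◇-mono ∧-elimʳ ∙ ◇-antitone (inj₁ β<γ) ∙ ◇-idem)
            , ◇-persist β<γ

  ◇-absorb : φ ∧' [ α ] (¬' φ) ⊩ ψ → ⟨ α ⟩ (φ ∧' ψ) ⟺ ⟨ α ⟩ φ
  ◇-absorb f = ◇-mono ∧-elimˡ , ◇-löb ∙ ◇-mono (∧-intro ∧-elimˡ f)

  ◇-⊥ : ⊢ ¬' φ → ⟨ α ⟩ φ ⟺ ⊥'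
  ◇-⊥ {α = α} ⊢¬φ = ⊩-absurd (⊢⇒⊩ (nec α ⊢¬φ)) ⊩-refl , ⊥-elim⊩

  -- Worms

  W : List Mod → Fm
  W []      = ⊤'
  W (β ∷ w) = ⟨ β ⟩ W w

  W-worm : ∀ w → Worm (W w)
  W-worm []      = top
  W-worm (β ∷ w) = cons β (W-worm w)

  ∈mod-W : ∀ w → β ∈mod W w → β ∈ w
  ∈mod-W []      (lift ())
  ∈mod-W (γ ∷ w) (inj₁ β≡γ) = here β≡γ
  ∈mod-W (γ ∷ w) (inj₂ β∈w) = there (∈mod-W w β∈w)

  W-∷-◇⊤ : α ≤ β → W (β ∷ A) ⊩ ⟨ α ⟩ ⊤'
  W-∷-◇⊤ α≤β = ◇-mono ⊤-intro ∙ ◇-antitone α≤β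

  W-++ : ∀ h b → All (β <_) h → W (h ++ β ∷ b) ⟺ W h ∧' ⟨ β ⟩ W b
  W-++ []      b []           = ∧-intro ⊤-intro ⊩-refl , ∧-elimʳ
  W-++ (γ ∷ h) b (β<γ ∷ β<h) = ◇-cong (W-++ h b β<h) ⟫ ◇-∧-◇ β<γ

  infix 4 _≺[_]_ _≺[>_]_
  _≺[_]_ : List Mod → Mod → List Mod → Set (a ⊔ ℓ₁ ⊔ ℓ₂)
  A ≺[ α ] B = W B ⊩ ⟨ α ⟩ W A

  _≺[>_]_ : List Mod → Mod → List Mod → Set (a ⊔ ℓ₁ ⊔ ℓ₂)
  A ≺[> γ ] B = Σ[ δ ∈ Mod ] γ < δ × A ≺[ δ ] B

  data Trichotomy {ℓ} (_≺_ : List Mod → List Mod → Set ℓ) (A B : List Mod)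
                  : Set (ℓ ⊔ a ⊔ ℓ₁ ⊔ ℓ₂) where
    equiv : W A ⟺ W B → Trichotomy _≺_ A B
    below : A ≺ B → Trichotomy _≺_ A B
    above : B ≺ A → Trichotomy _≺_ A B

  Trichotomy-map : ∀ {ℓ ℓ′} {_≺_ : List Mod → List Mod → Set ℓ} {_≺′_ : List Mod → List Mod → Set ℓ′} →
                   (∀ {A B} → A ≺ B → A ≺′ B) → Trichotomy _≺_ A B → Trichotomy _≺′_ A B
  Trichotomy-map f (equiv e) = equiv e
  Trichotomy-map f (below r) = below (f r)
  Trichotomy-map f (above r) = above (f r)

  least : ∀ x xs → Σ[ γ ∈ Mod ] γ ∈ x ∷ xs × All (γ ≤_) (x ∷ xs)
  least x xs = min x xs , [ here , there ]′ (argmin-sel id x xs) , min≤⊤ x xs ∷ min≤xs x xs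

  -- The split of w at the first occurrence of γ; if γ does not occur, the body is empty.
  record Decomposition (γ : Mod) (w : List Mod) : Set (a ⊔ ℓ₁ ⊔ ℓ₂) where
    field
      head body : List Mod
      head>γ    : All (γ <_) head
      body≥γ    : All (γ ≤_) body
      split     : W w ⟺ W head ∧' ⟨ γ ⟩ W body
      head⊆     : head ⊆ w
      body⊆     : body ⊆ w
      head≤     : length head ≤ℕ length w
      head<     : γ ∈ w → length head <ℕ length w
      body<     : length body <ℕ length w
  open Decomposition

  undecomposed : ∀ w → w ≢ [] → All (γ <_) w → Decomposition γ w
  undecomposed [] w≢[] _ = ⊥-elim (w≢[] refl)
  undecomposed {γ} w@(_ ∷ _) _ γ<w@(γ<β ∷ _) = record
    { head = w ; body = [] ; head>γ = γ<w ; body≥γ = []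
    ; split = ∧-intro ⊩-refl (W-∷-◇⊤ (inj₁ γ<β)) , ∧-elimˡ
    ; head⊆ = id ; body⊆ = λ () ; head≤ = ≤-refl
    ; head< = λ γ∈w → ⊥-elim (irrefl Eq.refl (lookup γ<w γ∈w)) ; body< = s≤s z≤n }

  decomposedAt : ∀ h b → All (γ <_) h → ¬ γ < β → All (γ ≤_) (h ++ β ∷ b) → Decomposition γ (h ++ β ∷ b)
  decomposedAt {γ} {β} h b γ<h γ≮β γ≤w with ++⁻ʳ h γ≤w
  ... | inj₁ γ<β ∷ _   = ⊥-elim (γ≮β γ<β)
  ... | inj₂ γ≈β ∷ γ≤b = record
    { head = h ; body = b ; head>γ = γ<h ; body≥γ = γ≤b
    ; split = W-++ h b (All.map (<-respˡ-≈ γ≈β) γ<h) ⟫ ∧-cong ⟺-refl (◇-resp-≈ (Eq.sym γ≈β))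
    ; head⊆ = xs⊆xs++ys h _ ; body⊆ = ⊆-trans (xs⊆x∷xs b β) (xs⊆ys++xs _ h)
    ; head≤ = length-++-≤ˡ h
    ; head< = λ _ → subst (length h <ℕ_) (sym (length-++ h)) (m<m+n (length h) (s≤s z≤n))
    ; body< = length-++-≤ʳ (β ∷ b) {h} }

  decompose : ∀ w → w ≢ [] → All (γ ≤_) w → Decomposition γ w
  decompose {γ} w w≢[] γ≤w with first (λ x → toSum (γ <? x)) w
  ... | inj₂ γ<w = undecomposed w w≢[] γ<w
  ... | inj₁ firstNotAbove with toView firstNotAbove
  ... | First._++_∷_ γ<h γ≮β b = decomposedAt _ b γ<h γ≮β γ≤w

  heads< : γ ∈ A ++ B → (dA : Decomposition γ A) (dB : Decomposition γ B) →
           length (head dA) + length (head dB) <ℕ length A + length B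
  heads< {A = A} γ∈ dA dB with ∈-++⁻ A γ∈
  ... | inj₁ γ∈A = +-mono-<-≤ (head< dA γ∈A) (head≤ dB)
  ... | inj₂ γ∈B = +-mono-≤-< (head≤ dA) (head< dB γ∈B)

  Comparable : ℕ → Set (a ⊔ ℓ₁ ⊔ ℓ₂)
  Comparable n = ∀ {α} A B → length A + length B <ℕ n → All (α ≤_) A → All (α ≤_) B →
                 Trichotomy _≺[ α ]_ A B

  compareAtLeast : ∀ {n} → Comparable n → δ ∈ A ++ B → All (δ ≤_) (A ++ B) → length A + length B <ℕ n →
                   All (γ <_) A → All (γ <_) B → Trichotomy _≺[> γ ]_ A B
  compareAtLeast {δ} {A} {B} ih δ∈ δ≤ lt γ<A γ<B =
    Trichotomy-map (λ A≺B → δ , lookup (++⁺ γ<A γ<B) δ∈ , A≺B) (ih A B lt (++⁻ˡ A δ≤) (++⁻ʳ A δ≤))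

  compareAbove : ∀ {n} → Comparable n → ∀ A B → length A + length B <ℕ n →
                 All (γ <_) A → All (γ <_) B → Trichotomy _≺[> γ ]_ A B
  compareAbove ih []      []      _ _ _ = equiv ⟺-refl
  compareAbove ih []      (y ∷ B) = let _ , δ∈ , δ≤ = least y B       in compareAtLeast ih δ∈ δ≤
  compareAbove ih (x ∷ A) B       = let _ , δ∈ , δ≤ = least x (A ++ B) in compareAtLeast ih δ∈ δ≤

  ≺-through-body : W B ⊩ ⟨ γ ⟩ W b → Trichotomy _≺[ γ ]_ A b → A ≺[ γ ] B ⊎ b ≺[ γ ] A
  ≺-through-body B⊩◇b (equiv (_ , b⊩A)) = inj₁ (B⊩◇b ∙ ◇-mono b⊩A)
  ≺-through-body B⊩◇b (below A≺b)       = inj₁ (B⊩◇b ∙ ◇-mono A≺b ∙ ◇-idem)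
  ≺-through-body _    (above b≺A)       = inj₂ b≺A

  ≺-through-heads : (dA : Decomposition γ A) → W B ⊩ W h → W B ⊩ ⟨ γ ⟩ W (body dA) →
                    head dA ≺[> γ ] h → A ≺[ γ ] B
  ≺-through-heads dA B⊩h B⊩◇bA (δ , γ<δ , hA≺h) =
    ∧-intro (B⊩h ∙ hA≺h) B⊩◇bA ∙ ◇-persist γ<δ ∙ ◇-mono (proj₂ (split dA)) ∙ ◇-antitone (inj₁ γ<δ)

  -- Unless one body already decides the comparison, A ⊢ ⟨γ⟩ bB and B ⊢ ⟨γ⟩ bA, and then
  -- the heads, whose modalities exceed γ, decide it.
  compareDecomposed : ∀ {n} → Comparable n → γ ∈ A ++ B → (dA : Decomposition γ A) (dB : Decomposition γ B) →
                 length A + length B ≤ℕ n → All (γ ≤_) A → All (γ ≤_) B → Trichotomy _≺[ γ ]_ A B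
  compareDecomposed {A = A} {B} {n} ih γ∈ dA dB le γ≤A γ≤B
    with ≺-through-body (proj₁ (split dB) ∙ ∧-elimʳ) (ih A (body dB) A+bB<n γ≤A (body≥γ dB))
       | ≺-through-body (proj₁ (split dA) ∙ ∧-elimʳ) (ih B (body dA) B+bA<n γ≤B (body≥γ dA))
    where
    A+bB<n : length A + length (body dB) <ℕ n
    A+bB<n = <-≤ℕ-trans (+-monoʳ-< (length A) (body< dB)) le
    B+bA<n : length B + length (body dA) <ℕ n
    B+bA<n = <-≤ℕ-trans (+-monoʳ-< (length B) (body< dA)) (subst (_≤ℕ n) (+-comm (length A) (length B)) le)
  ... | inj₁ A≺B | _       = below A≺B
  ... | inj₂ _   | inj₁ B≺A = above B≺A
  ... | inj₂ bB≺A | inj₂ bA≺B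
    with compareAbove ih (head dA) (head dB) (<-≤ℕ-trans (heads< γ∈ dA dB) le) (head>γ dA) (head>γ dB)
  ... | equiv (hA⊩hB , hB⊩hA) =
        equiv ( ∧-intro (proj₁ (split dA) ∙ ∧-elimˡ ∙ hA⊩hB) bB≺A ∙ proj₂ (split dB)
              , ∧-intro (proj₁ (split dB) ∙ ∧-elimˡ ∙ hB⊩hA) bA≺B ∙ proj₂ (split dA))
  ... | below hA≺hB = below (≺-through-heads dA (proj₁ (split dB) ∙ ∧-elimˡ) bA≺B hA≺hB)
  ... | above hB≺hA = above (≺-through-heads dB (proj₁ (split dA) ∙ ∧-elimˡ) bB≺A hB≺hA)

  compareBounded : ∀ n → Comparable n
  compareBounded zero    _       _       ()
  compareBounded (suc n) []      []      _ _ _               = equiv ⟺-refl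
  compareBounded (suc n) []      (_ ∷ _) _ _ (α≤β ∷ _)       = below (W-∷-◇⊤ α≤β)
  compareBounded (suc n) (_ ∷ _) []      _ (α≤β ∷ _) _       = above (W-∷-◇⊤ α≤β)
  compareBounded (suc n) A@(x ∷ A′) B@(_ ∷ _) A+B≤n α≤A α≤B =
    let γ , γ∈ , γ≤ = least x (A′ ++ B)
        γ≤A = ++⁻ˡ A γ≤
        γ≤B = ++⁻ʳ A γ≤
    in Trichotomy-map (_∙ ◇-antitone (lookup (++⁺ α≤A α≤B) γ∈))
         (compareDecomposed (compareBounded n) γ∈ (decompose A (λ ()) γ≤A) (decompose B (λ ()) γ≤B)
                       (≤-pred A+B≤n) γ≤A γ≤B)

  compare-worms : All (α ≤_) A → All (α ≤_) B → Trichotomy _≺[ α ]_ A B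
  compare-worms = compareBounded _ _ _ (n<1+n _)

  ++-⊆ : ∀ {xs ys zs : List Mod} → xs ⊆ zs → ys ⊆ zs → xs ++ ys ⊆ zs
  ++-⊆ {xs} xs⊆zs ys⊆zs x∈ = [ xs⊆zs , ys⊆zs ]′ (∈-++⁻ xs x∈)

  ◇-∧-strongest : Trichotomy _≺[ γ ]_ A B →
                  Σ[ C ∈ List Mod ] (⟨ γ ⟩ W A ∧' ⟨ γ ⟩ W B ⟺ ⟨ γ ⟩ W C) × C ⊆ A ++ B
  ◇-∧-strongest {A = A} {B} (equiv (A⊩B , _)) =
    A , (∧-elimˡ , ∧-intro ⊩-refl (◇-mono A⊩B)) , xs⊆xs++ys A B
  ◇-∧-strongest {A = A} {B} (below A≺B) =
    B , (∧-elimʳ , ∧-intro (◇-mono A≺B ∙ ◇-idem) ⊩-refl) , xs⊆ys++xs B A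
  ◇-∧-strongest {A = A} {B} (above B≺A) =
    A , (∧-elimˡ , ∧-intro ⊩-refl (◇-mono B≺A ∙ ◇-idem)) , xs⊆xs++ys A B

  mergeBounded : ∀ n A B → length A + length B <ℕ n →
                 Σ[ C ∈ List Mod ] (W A ∧' W B ⟺ W C) × C ⊆ A ++ B
  mergeBounded n       []         B          _ = B , (∧-elimʳ , ∧-intro ⊤-intro ⊩-refl) , ⊆-refl
  mergeBounded n       A@(_ ∷ _)  []         _ = A , (∧-elimˡ , ∧-intro ⊩-refl ⊤-intro) , xs⊆xs++ys A []
  mergeBounded zero    (_ ∷ _)    (_ ∷ _)    ()
  mergeBounded (suc n) A@(x ∷ A′) B@(_ ∷ _) A+B≤n =
    let γ , γ∈ , γ≤ = least x (A′ ++ B)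
        dA = decompose A (λ ()) (++⁻ˡ A γ≤)
        dB = decompose B (λ ()) (++⁻ʳ A γ≤)
        h , hA∧hB⟺h , h⊆ = mergeBounded n (head dA) (head dB) (<-≤ℕ-trans (heads< γ∈ dA dB) (≤-pred A+B≤n))
        b , ◇bA∧◇bB⟺◇b , b⊆ = ◇-∧-strongest (compare-worms (body≥γ dA) (body≥γ dB))
        γ<h = All-resp-⊇ h⊆ (++⁺ (head>γ dA) (head>γ dB))
    in h ++ γ ∷ b
     , ∧-cong (split dA) (split dB) ⟫ ∧-interchange ⟫ ∧-cong hA∧hB⟺h ◇bA∧◇bB⟺◇b ⟫ ⟺-sym (W-++ h b γ<h)
     , ++-⊆ (⊆-trans h⊆ (++-⊆⁺ (head⊆ dA) (head⊆ dB)))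
            (∈-∷⁺ʳ γ∈ (⊆-trans b⊆ (++-⊆⁺ (body⊆ dA) (body⊆ dB))))

  merge : ∀ A B → Σ[ C ∈ List Mod ] (W A ∧' W B ⟺ W C) × C ⊆ A ++ B
  merge A B = mergeBounded _ A B (n<1+n _)

  entails-or-excludes : All (α ≤_) A → All (α ≤_) B → (W A ⊩ W B) ⊎ (W A ∧' [ α ] (¬' W A) ⊩ ¬' W B)
  entails-or-excludes {α} {A} {B} α≤A α≤B with merge A B
  ... | C , A∧B⟺C , C⊆ with compare-worms α≤A (All-resp-⊇ C⊆ (++⁺ α≤A α≤B))
  ... | equiv (A⊩C , _) = inj₁ (A⊩C ∙ proj₂ A∧B⟺C ∙ ∧-elimʳ)
  ... | below A≺C       = inj₂ (⊩-¬-intro (∧-mono ∧-elimˡ ⊩-refl ∙ proj₁ A∧B⟺C ∙ A≺C) ∧-elimʳ)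
  ... | above C≺A       = inj₂ (⊩-¬-intro (∧-mono ∧-elimˡ ⊩-refl ∙ proj₁ A∧B⟺C ∙ explode ⊢¬C) ⊤-intro)
    where
    ⊢¬C : ⊢ ¬' W C
    ⊢¬C = löb-rule (proj₂ A∧B⟺C ∙ ∧-elimˡ ∙ C≺A)

  noneOf : List (List Mod) → Fm
  noneOf []       = ⊤'
  noneOf (B ∷ Bs) = ¬' W B ∧' noneOf Bs

  inconsistent-or-excludes : ∀ {Bs} → All (α ≤_) A → All (All (α ≤_)) Bs →
                 (⊢ ¬' (W A ∧' noneOf Bs)) ⊎ (W A ∧' [ α ] (¬' W A) ⊩ noneOf Bs)
  inconsistent-or-excludes α≤A []            = inj₂ ⊤-intro
  inconsistent-or-excludes α≤A (α≤B ∷ α≤Bs)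
    with entails-or-excludes α≤A α≤B | inconsistent-or-excludes α≤A α≤Bs
  ... | inj₁ A⊩B | _       = inj₁ (refute (⊩-absurd (∧-elimˡ ∙ A⊩B) (∧-elimʳ ∙ ∧-elimˡ)))
  ... | inj₂ _   | inj₁ ⊢¬ = inj₁ (refute (∧-mono ⊩-refl ∧-elimʳ ∙ explode ⊢¬))
  ... | inj₂ f   | inj₂ g  = inj₂ (∧-intro f g)

  -- Boolean combinations of worms

  data Comb : Set a where
    wormᶜ : List Mod → Comb
    ¬ᶜ_   : Comb → Comb
    _∧ᶜ_  : Comb → Comb → Comb

  ⟦_⟧ : Comb → Fm
  ⟦ wormᶜ w ⟧ = W w
  ⟦ ¬ᶜ t ⟧    = ¬' ⟦ t ⟧
  ⟦ s ∧ᶜ t ⟧  = ⟦ s ⟧ ∧' ⟦ t ⟧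

  ⟦⟧-BCW : ∀ t → BCW ⟦ t ⟧
  ⟦⟧-BCW (wormᶜ w) = worm (W-worm w)
  ⟦⟧-BCW (¬ᶜ t)    = neg (⟦⟧-BCW t)
  ⟦⟧-BCW (s ∧ᶜ t)  = conj (⟦⟧-BCW s) (⟦⟧-BCW t)

  Leaves : ∀ {ℓ} → (List Mod → Set ℓ) → Comb → Set ℓ
  Leaves P (wormᶜ w) = P w
  Leaves P (¬ᶜ t)    = Leaves P t
  Leaves P (s ∧ᶜ t)  = Leaves P s × Leaves P t

  record Expressible {s} (S : Mod → Set s) (φ : Fm) : Set (a ⊔ ℓ₁ ⊔ ℓ₂ ⊔ s) where
    constructor expressed
    field
      comb       : Comb
      equivalent : φ ⟺ ⟦ comb ⟧
      modalities : Leaves (All S) comb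

  module _ {s} {S : Mod → Set s} where

    ∈mod-⟦⟧ : ∀ t → Leaves (All S) t → β ∈mod ⟦ t ⟧ → S β
    ∈mod-⟦⟧ (wormᶜ w) Sw      β∈ = lookup Sw (∈mod-W w β∈)
    ∈mod-⟦⟧ (¬ᶜ t)    St      β∈ = ∈mod-⟦⟧ t St β∈
    ∈mod-⟦⟧ (s ∧ᶜ t)  (Ss , _) (inj₁ β∈) = ∈mod-⟦⟧ s Ss β∈
    ∈mod-⟦⟧ (s ∧ᶜ t)  (_ , St) (inj₂ β∈) = ∈mod-⟦⟧ t St β∈

    expressible-resp : φ ⟺ ψ → Expressible S ψ → Expressible S φ
    expressible-resp φ⟺ψ (expressed t ψ⟺t St) = expressed t (φ⟺ψ ⟫ ψ⟺t) St

    ⊤-expressible : Expressible S ⊤'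
    ⊤-expressible = expressed (wormᶜ []) ⟺-refl []

    ¬-expressible : Expressible S φ → Expressible S (¬' φ)
    ¬-expressible (expressed t φ⟺t St) = expressed (¬ᶜ t) (¬-cong φ⟺t) St

    ∧-expressible : Expressible S φ → Expressible S ψ → Expressible S (φ ∧' ψ)
    ∧-expressible (expressed s φ⟺s Ss) (expressed t ψ⟺t St) = expressed (s ∧ᶜ t) (∧-cong φ⟺s ψ⟺t) (Ss , St)

    ∨-expressible : Expressible S φ → Expressible S ψ → Expressible S (φ ∨' ψ)
    ∨-expressible eφ eψ = ¬-expressible (∧-expressible (¬-expressible eφ) (¬-expressible eψ))

    ⊥-expressible : Expressible S ⊥'
    ⊥-expressible = ¬-expressible ⊤-expressible

  expressible-mono : ∀ {s s′} {S : Mod → Set s} {S′ : Mod → Set s′} →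
                     (∀ {β} → S β → S′ β) → Expressible S φ → Expressible S′ φ
  expressible-mono S⊆S′ (expressed t φ⟺t St) = expressed t φ⟺t (Leaves-map t St)
    where
    Leaves-map : ∀ t → Leaves (All _) t → Leaves (All _) t
    Leaves-map (wormᶜ w) Sw        = All.map S⊆S′ Sw
    Leaves-map (¬ᶜ t)    St        = Leaves-map t St
    Leaves-map (s ∧ᶜ t)  (Ss , St) = Leaves-map s Ss , Leaves-map t St

  Literal : Set a
  Literal = Bool × List Mod

  literal : Literal → Fm
  literal (true  , w) = W w
  literal (false , w) = ¬' W w

  conjunction : List Literal → Fm
  conjunction []      = ⊤'
  conjunction (l ∷ T) = literal l ∧' conjunction T

  disjunction : List (List Literal) → Fm
  disjunction []      = ⊥'
  disjunction (T ∷ D) = conjunction T ∨' disjunction D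

  mutual
    dnf : Comb → List (List Literal)
    dnf (wormᶜ w) = ((true , w) ∷ []) ∷ []
    dnf (¬ᶜ t)    = dnf¬ t
    dnf (s ∧ᶜ t)  = cartesianProductWith _++_ (dnf s) (dnf t)

    dnf¬ : Comb → List (List Literal)
    dnf¬ (wormᶜ w) = ((false , w) ∷ []) ∷ []
    dnf¬ (¬ᶜ t)    = dnf t
    dnf¬ (s ∧ᶜ t)  = dnf¬ s ++ dnf¬ t

  module _ (v : Fm → Bool) where
    private
      ⟦_⟧ᵛ : Fm → Bool
      ⟦_⟧ᵛ = eval v
      ∧ᵛ : List Literal → Bool
      ∧ᵛ T = ⟦ conjunction T ⟧ᵛ
      ∨ᵛ : List (List Literal) → Bool
      ∨ᵛ D = ⟦ disjunction D ⟧ᵛ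

    eval-∨ : ∀ φ ψ → ⟦ φ ∨' ψ ⟧ᵛ ≡ ⟦ φ ⟧ᵛ ∨ ⟦ ψ ⟧ᵛ
    eval-∨ φ ψ with ⟦ φ ⟧ᵛ
    ... | true  = refl
    ... | false = not-involutive ⟦ ψ ⟧ᵛ

    eval-conjunction-++ : ∀ T U → ∧ᵛ (T ++ U) ≡ ∧ᵛ T ∧ ∧ᵛ U
    eval-conjunction-++ []      U = refl
    eval-conjunction-++ (l ∷ T) U =
      trans (cong (⟦ literal l ⟧ᵛ ∧_) (eval-conjunction-++ T U)) (sym (∧-assoc ⟦ literal l ⟧ᵛ (∧ᵛ T) (∧ᵛ U)))

    eval-disjunction-++ : ∀ D E → ∨ᵛ (D ++ E) ≡ ∨ᵛ D ∨ ∨ᵛ E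
    eval-disjunction-++ []      E = refl
    eval-disjunction-++ (T ∷ D) E = begin
      ∨ᵛ (T ∷ D ++ E)            ≡⟨ eval-∨ (conjunction T) (disjunction (D ++ E)) ⟩
      ∧ᵛ T ∨ ∨ᵛ (D ++ E)         ≡⟨ cong (∧ᵛ T ∨_) (eval-disjunction-++ D E) ⟩
      ∧ᵛ T ∨ (∨ᵛ D ∨ ∨ᵛ E)       ≡⟨ sym (∨-assoc (∧ᵛ T) (∨ᵛ D) (∨ᵛ E)) ⟩
      (∧ᵛ T ∨ ∨ᵛ D) ∨ ∨ᵛ E       ≡⟨ cong (_∨ ∨ᵛ E) (sym (eval-∨ (conjunction T) (disjunction D))) ⟩
      ∨ᵛ (T ∷ D) ∨ ∨ᵛ E          ∎
      where open ≡-Reasoning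

    eval-disjunction-map : ∀ T E → ∨ᵛ (map (T ++_) E) ≡ ∧ᵛ T ∧ ∨ᵛ E
    eval-disjunction-map T []      = sym (∧-zeroʳ (∧ᵛ T))
    eval-disjunction-map T (U ∷ E) = begin
      ∨ᵛ (map (T ++_) (U ∷ E))              ≡⟨ eval-∨ (conjunction (T ++ U)) (disjunction (map (T ++_) E)) ⟩
      ∧ᵛ (T ++ U) ∨ ∨ᵛ (map (T ++_) E)      ≡⟨ cong₂ _∨_ (eval-conjunction-++ T U) (eval-disjunction-map T E) ⟩
      (∧ᵛ T ∧ ∧ᵛ U) ∨ (∧ᵛ T ∧ ∨ᵛ E)         ≡⟨ sym (∧-distribˡ-∨ (∧ᵛ T) (∧ᵛ U) (∨ᵛ E)) ⟩
      ∧ᵛ T ∧ (∧ᵛ U ∨ ∨ᵛ E)                  ≡⟨ cong (∧ᵛ T ∧_) (sym (eval-∨ (conjunction U) (disjunction E))) ⟩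
      ∧ᵛ T ∧ ∨ᵛ (U ∷ E)                     ∎
      where open ≡-Reasoning

    eval-disjunction-× : ∀ D E → ∨ᵛ (cartesianProductWith _++_ D E) ≡ ∨ᵛ D ∧ ∨ᵛ E
    eval-disjunction-× []      E = refl
    eval-disjunction-× (T ∷ D) E = begin
      ∨ᵛ (map (T ++_) E ++ cartesianProductWith _++_ D E)
        ≡⟨ eval-disjunction-++ (map (T ++_) E) (cartesianProductWith _++_ D E) ⟩
      ∨ᵛ (map (T ++_) E) ∨ ∨ᵛ (cartesianProductWith _++_ D E)
        ≡⟨ cong₂ _∨_ (eval-disjunction-map T E) (eval-disjunction-× D E) ⟩
      (∧ᵛ T ∧ ∨ᵛ E) ∨ (∨ᵛ D ∧ ∨ᵛ E)   ≡⟨ sym (∧-distribʳ-∨ (∨ᵛ E) (∧ᵛ T) (∨ᵛ D)) ⟩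
      (∧ᵛ T ∨ ∨ᵛ D) ∧ ∨ᵛ E            ≡⟨ cong (_∧ ∨ᵛ E) (sym (eval-∨ (conjunction T) (disjunction D))) ⟩
      ∨ᵛ (T ∷ D) ∧ ∨ᵛ E               ∎
      where open ≡-Reasoning

    eval-singleton : ∀ l → ∨ᵛ ((l ∷ []) ∷ []) ≡ ⟦ literal l ⟧ᵛ
    eval-singleton l = begin
      ∨ᵛ ((l ∷ []) ∷ [])             ≡⟨ eval-∨ (conjunction (l ∷ [])) ⊥' ⟩
      (⟦ literal l ⟧ᵛ ∧ true) ∨ false ≡⟨ ∨-identityʳ _ ⟩
      ⟦ literal l ⟧ᵛ ∧ true           ≡⟨ ∧-identityʳ _ ⟩
      ⟦ literal l ⟧ᵛ                  ∎
      where open ≡-Reasoning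

    mutual
      eval-dnf : ∀ t → ∨ᵛ (dnf t) ≡ ⟦ ⟦ t ⟧ ⟧ᵛ
      eval-dnf (wormᶜ w) = eval-singleton (true , w)
      eval-dnf (¬ᶜ t)    = eval-dnf¬ t
      eval-dnf (s ∧ᶜ t)  = trans (eval-disjunction-× (dnf s) (dnf t)) (cong₂ _∧_ (eval-dnf s) (eval-dnf t))

      eval-dnf¬ : ∀ t → ∨ᵛ (dnf¬ t) ≡ not ⟦ ⟦ t ⟧ ⟧ᵛ
      eval-dnf¬ (wormᶜ w) = eval-singleton (false , w)
      eval-dnf¬ (¬ᶜ t)    = trans (eval-dnf t) (sym (not-involutive ⟦ ⟦ t ⟧ ⟧ᵛ))
      eval-dnf¬ (s ∧ᶜ t)  = begin
        ∨ᵛ (dnf¬ s ++ dnf¬ t)             ≡⟨ eval-disjunction-++ (dnf¬ s) (dnf¬ t) ⟩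
        ∨ᵛ (dnf¬ s) ∨ ∨ᵛ (dnf¬ t)         ≡⟨ cong₂ _∨_ (eval-dnf¬ s) (eval-dnf¬ t) ⟩
        not ⟦ ⟦ s ⟧ ⟧ᵛ ∨ not ⟦ ⟦ t ⟧ ⟧ᵛ   ≡⟨ sym (deMorgan₁ ⟦ ⟦ s ⟧ ⟧ᵛ ⟦ ⟦ t ⟧ ⟧ᵛ) ⟩
        not (⟦ ⟦ s ⟧ ⟧ᵛ ∧ ⟦ ⟦ t ⟧ ⟧ᵛ)      ∎
        where open ≡-Reasoning

  dnf-sound : ∀ t → ⟦ t ⟧ ⟺ disjunction (dnf t)
  dnf-sound t = ⟺-by-eval λ v → sym (eval-dnf v t)

  module _ {ℓ} {P : List Mod → Set ℓ} where
    mutual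
      dnf-leaves : ∀ t → Leaves P t → All (All (P ∘ proj₂)) (dnf t)
      dnf-leaves (wormᶜ w) Pw        = (Pw ∷ []) ∷ []
      dnf-leaves (¬ᶜ t)    Pt        = dnf¬-leaves t Pt
      dnf-leaves (s ∧ᶜ t)  (Ps , Pt) =
        cartesianProductWith⁺ (setoid _) (setoid _) _++_ (dnf s) (dnf t)
          λ T∈ U∈ → ++⁺ (lookup (dnf-leaves s Ps) T∈) (lookup (dnf-leaves t Pt) U∈)

      dnf¬-leaves : ∀ t → Leaves P t → All (All (P ∘ proj₂)) (dnf¬ t)
      dnf¬-leaves (wormᶜ w) Pw        = (Pw ∷ []) ∷ []
      dnf¬-leaves (¬ᶜ t)    Pt        = dnf-leaves t Pt
      dnf¬-leaves (s ∧ᶜ t)  (Ps , Pt) = ++⁺ (dnf¬-leaves s Ps) (dnf¬-leaves t Pt)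

  -- Eliminating ⟨α⟩

  Persistent : Mod → Fm → Set (a ⊔ ℓ₁ ⊔ ℓ₂)
  Persistent α φ = (φ ⊩ [ α ] φ) × (¬' φ ⊩ [ α ] (¬' φ))

  persistent-◇ : β < α → Persistent α (⟨ β ⟩ φ)
  persistent-◇ {β} {α} β<α = ax4 β α _ β<α , ¬¬-elim ∙ ax3 β α _ (inj₁ β<α) ∙ □-mono ¬¬-intro

  persistent-¬ : Persistent α φ → Persistent α (¬' φ)
  persistent-¬ (φ⊩□φ , ¬φ⊩□¬φ) = ¬φ⊩□¬φ , ¬¬-elim ∙ φ⊩□φ ∙ □-mono ¬¬-intro

  persistent-∧ : Persistent α φ → Persistent α ψ → Persistent α (φ ∧' ψ)
  persistent-∧ (φ⊩□φ , ¬φ⊩□¬φ) (ψ⊩□ψ , ¬ψ⊩□¬ψ) =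
    ∧-mono φ⊩□φ ψ⊩□ψ ∙ □-∧ ,
    ¬-∧-elim ∙ ∨-elim (¬φ⊩□¬φ ∙ □-mono (contrapose ∧-elimˡ)) (¬ψ⊩□¬ψ ∙ □-mono (contrapose ∧-elimʳ))

  persistent-⊤ : Persistent α ⊤'
  persistent-⊤ {α} = ⊢⇒⊩ (nec α (valid λ _ → ⊨⊤)) , ⊥-elim⊩

  ◇-∧-persistent : Persistent α φ → ⟨ α ⟩ (φ ∧' ψ) ⟺ φ ∧' ⟨ α ⟩ ψ
  ◇-∧-persistent (φ⊩□φ , ¬φ⊩□¬φ) =
    ∧-intro (contrapose⁻ (¬φ⊩□¬φ ∙ □-mono (contrapose ∧-elimˡ) ∙ ¬¬-intro)) (◇-mono ∧-elimʳ) ,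
    ∧-mono φ⊩□φ ⊩-refl ∙ ∧-comm ∙ ◇-∧-□ ∙ ◇-mono ∧-comm

  module Reduction (α : Mod) {s} {S : Mod → Set s} where

    High : Mod → Set (ℓ₁ ⊔ ℓ₂ ⊔ s)
    High β = α ≤ β × S β

    data Separated : List Mod → Set (a ⊔ ℓ₁ ⊔ ℓ₂ ⊔ s) where
      high : ∀ {w} → All High w → Separated w
      low  : ∀ {β w} → β < α → All S (β ∷ w) → Separated (β ∷ w)

    separate-worm : ∀ w → All S w → Σ[ c ∈ Comb ] (W w ⟺ ⟦ c ⟧) × Leaves Separated c
    separate-worm w Sw with first (≤⊎> α) w
    ... | inj₂ α≤w = wormᶜ w , ⟺-refl , high (All.zip (α≤w , Sw))
    ... | inj₁ firstBelow with toView firstBelow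
    ... | First._++_∷_ {h} α≤h β<α r =
          wormᶜ h ∧ᶜ wormᶜ (_ ∷ r) , W-++ h r (All.map (<-≤-trans β<α) α≤h)
        , high (All.zip (α≤h , ++⁻ˡ h Sw)) , low β<α (++⁻ʳ h Sw)

    separate : ∀ t → Leaves (All S) t → Σ[ c ∈ Comb ] (⟦ t ⟧ ⟺ ⟦ c ⟧) × Leaves Separated c
    separate (wormᶜ w) Sw        = separate-worm w Sw
    separate (¬ᶜ t)    St        = let c , t⟺c , sep = separate t St in ¬ᶜ c , ¬-cong t⟺c , sep
    separate (s ∧ᶜ t)  (Ss , St) =
      let c , s⟺c , sepc = separate s Ss
          d , t⟺d , sepd = separate t St
      in c ∧ᶜ d , ∧-cong s⟺c t⟺d , sepc , sepd

    record Separation (φ : Fm) : Set (a ⊔ ℓ₁ ⊔ ℓ₂ ⊔ s) where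
      constructor separation
      field
        lowPart            : Comb
        highPart           : List Mod
        excluded           : List (List Mod)
        separates          : φ ⟺ ⟦ lowPart ⟧ ∧' (W highPart ∧' noneOf excluded)
        lowPart-persistent : Persistent α ⟦ lowPart ⟧
        lowPart-modalities : Leaves (All S) lowPart
        highPart-high      : All High highPart
        excluded-high      : All (All High) excluded

    addLow : ∀ c → Persistent α ⟦ c ⟧ → Leaves (All S) c → Separation φ → Separation (⟦ c ⟧ ∧' φ)
    addLow c c-persistent Sc (separation L A N φ⟺ L-persistent SL HA HN) =
      separation (c ∧ᶜ L) A N
        (∧-cong ⟺-refl φ⟺ ⟫ ⟺-by-eval λ v → sym (∧-assoc (eval v ⟦ c ⟧) _ _))
        (persistent-∧ c-persistent L-persistent) (Sc , SL) HA HN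

    addLiteral : ∀ {w} b → Separated w → Separation φ → Separation (literal (b , w) ∧' φ)
    addLiteral {w = w} true (high Hw) (separation L A N φ⟺ L-persistent SL HA HN) with merge w A
    ... | C , w∧A⟺C , C⊆ =
      separation L C N
        (∧-cong ⟺-refl φ⟺
          ⟫ ⟺-by-eval (λ v → solve 4 (λ x l a n → x ⊕ (l ⊕ (a ⊕ n)) ⊜ l ⊕ ((x ⊕ a) ⊕ n)) refl
                            (eval v (W w)) (eval v ⟦ L ⟧) (eval v (W A)) (eval v (noneOf N)))
          ⟫ ∧-cong ⟺-refl (∧-cong w∧A⟺C ⟺-refl))
        L-persistent SL (All-resp-⊇ C⊆ (++⁺ Hw HA)) HN
    addLiteral {w = w} false (high Hw) (separation L A N φ⟺ L-persistent SL HA HN) =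
      separation L A (_ ∷ N)
        (∧-cong ⟺-refl φ⟺
          ⟫ ⟺-by-eval (λ v → solve 4 (λ x l a n → x ⊕ (l ⊕ (a ⊕ n)) ⊜ l ⊕ (a ⊕ (x ⊕ n))) refl
                            (eval v (¬' W w)) (eval v ⟦ L ⟧) (eval v (W A)) (eval v (noneOf N))))
        L-persistent SL HA (Hw ∷ HN)
    addLiteral true  (low β<α Sw) = addLow (wormᶜ _) (persistent-◇ β<α) Sw
    addLiteral false (low β<α Sw) = addLow (¬ᶜ wormᶜ _) (persistent-¬ (persistent-◇ β<α)) Sw

    separateTerm : ∀ T → All (Separated ∘ proj₂) T → Separation (conjunction T)
    separateTerm []            []           =
      separation (wormᶜ []) [] [] (∧-intro ⊤-intro (∧-intro ⊤-intro ⊤-intro) , ⊤-intro) persistent-⊤ [] [] []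
    separateTerm ((b , _) ∷ T) (sep ∷ seps) = addLiteral b sep (separateTerm T seps)

    ◇-separation : S α → Separation φ → Expressible S (⟨ α ⟩ φ)
    ◇-separation Sα (separation L A N φ⟺ L-persistent SL HA HN)
      with inconsistent-or-excludes (All.map proj₁ HA) (All.map (All.map proj₁) HN)
    ... | inj₁ ⊢¬A∧N   = expressible-resp (◇-cong φ⟺ ⟫ ◇-⊥ (refute (∧-elimʳ ∙ explode ⊢¬A∧N))) ⊥-expressible
    ... | inj₂ A∧□¬A⊩N = expressed (L ∧ᶜ wormᶜ (α ∷ A))
      (◇-cong φ⟺ ⟫ ◇-∧-persistent L-persistent ⟫ ∧-cong ⟺-refl (◇-absorb A∧□¬A⊩N))
      (SL , Sα ∷ All.map proj₂ HA)

    ◇-disjunction : S α → ∀ D → All (All (Separated ∘ proj₂)) D → Expressible S (⟨ α ⟩ disjunction D)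
    ◇-disjunction Sα []      []           = expressible-resp (◇-⊥ ⊢¬⊥) ⊥-expressible
    ◇-disjunction Sα (T ∷ D) (sepT ∷ sepD) = expressible-resp ◇-distrib-∨
      (∨-expressible (◇-separation Sα (separateTerm T sepT)) (◇-disjunction Sα D sepD))

    ◇-expressible : S α → Expressible S φ → Expressible S (⟨ α ⟩ φ)
    ◇-expressible Sα (expressed t φ⟺t St) =
      let c , t⟺c , sep = separate t St in
      expressible-resp (◇-cong (φ⟺t ⟫ t⟺c ⟫ dnf-sound c)) (◇-disjunction Sα (dnf c) (dnf-leaves c sep))

  open Reduction using (◇-expressible)

  □-expressible : ∀ {s} {S : Mod → Set s} → S α → Expressible S φ → Expressible S ([ α ] φ)
  □-expressible {α} Sα eφ =
    expressible-resp □-◇-duality (¬-expressible (◇-expressible α Sα (¬-expressible eφ)))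

  normalForm : ∀ φ → Closed φ → Expressible (_∈mod φ) φ
  normalForm ⊤'        _          = ⊤-expressible
  normalForm (¬' φ)    closed     = ¬-expressible (normalForm φ closed)
  normalForm (φ ∧' ψ)  (cφ , cψ)  =
    ∧-expressible (expressible-mono inj₁ (normalForm φ cφ)) (expressible-mono inj₂ (normalForm ψ cψ))
  normalForm ([ α ] φ) closed     = □-expressible (inj₁ refl) (expressible-mono inj₂ (normalForm φ closed))

mainTheorem20 : {a ℓ₁ ℓ₂ : Level} (Λ : StrictTotalOrder a ℓ₁ ℓ₂) →
    let open GLP Λ in
      (φ : Fm) → Closed φ →
      Σ Fm (λ ψ → BCW ψ × (⊢ (φ ⇔ ψ)) × (∀ α → α ∈mod ψ → α ∈mod φ))
mainTheorem20 Λ φ closed with WormNormalForm.normalForm Λ φ closed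
... | WormNormalForm.expressed t φ⟺t modalities-of-t = ⟦ t ⟧ , ⟦⟧-BCW t , ⟺⇒⊢⇔ φ⟺t , λ _ → ∈mod-⟦⟧ t modalities-of-t
  where open WormNormalForm Λ
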